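{- Let $G=(V,E)$ be a $d$-regular graph. Then for every $d\geq 3$, the graph $G\circ_z K_d$ is connected. If $d\geq 3$ is odd, then the graph $G\circ_z C_d$ is connected.
   Context: $G$ is a finite connected $d$-regular graph with an arbitrary bi-labelling (distinct colors from $[d]=\{1,\dots,d\}$ on the edges at each vertex, encoded by a rotation map $\operatorname{Rot}_G(v,h)=(w,k)$ if an edge joins $v,w$ colored $h$ near $v$ and $k$ near $w$); $K_d$ is the complete graph and $C_d$ the cycle graph on $d$ vertices, each with some bi-labelling. For a $d$-regular $G_1$ and a regular $G_2$ on $d$ vertices (identified with $[d]$), the zig-zag product $G_1\circ_z G_2$ has vertex set $V_1\times[d]$ and rotation map $\operatorname{Rot}((v,k),(i,j))=((w,l),(j',i'))$ whenever $\operatorname{Rot}_{G_2}(k,i)=(k',i')$, $\operatorname{Rot}_{G_1}(v,k')=(w,l')$, $\operatorname{Rot}_{G_2}(l',j)=(l,j')$. -}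

module Defs where

open import Data.Nat using (ℕ; zero; suc)
open import Data.Fin using (Fin; toℕ)
open import Data.Product using (_×_; _,_; proj₁; ∃)
open import Data.Sum using (_⊎_)
open import Relation.Binary.PropositionalEquality using (_≡_; _≢_)
open import Relation.Binary.Construct.Closure.ReflexiveTransitive using (Star)

-- A regular multigraph with a bi-labelling, given by its rotation map.
-- Vertices V, edge labels (colours) L; for a d-regular graph L = Fin d.
-- Rot(v,h) = (w,k) : the edge at v coloured h goes to w, coloured k at w.
-- Being an involution encodes that edges are consistently labelled and
-- that the colours at each vertex are distinct.
record RotMap (V L : Set) : Set where
  field
    rot   : V × L → V × L
    invol : ∀ x → rot (rot x) ≡ x
open RotMap public

nbr : {V L : Set} → RotMap V L → V → L → V
nbr G v h = proj₁ (rot G (v , h))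

Adj : {V L : Set} → (V × L → V × L) → V → V → Set
Adj {L = L} r v w = ∃ λ (h : L) → proj₁ (r (v , h)) ≡ w

Connected : {V L : Set} → (V × L → V × L) → Set
Connected {V} r = ∀ (v w : V) → Star (Adj r) v w

zigzag : {V L : Set} {d : ℕ} → RotMap V (Fin d) → RotMap (Fin d) L →
         ((V × Fin d) × (L × L) → (V × Fin d) × (L × L))
zigzag G₁ G₂ ((v , k) , (i , j)) with rot G₂ (k , i)
... | (k′ , i′) with rot G₁ (v , k′)
... | (w , l′) with rot G₂ (l′ , j)
... | (l , j′) = ((w , l) , (j′ , i′))

IsComplete : {d : ℕ} {L : Set} → RotMap (Fin d) L → Set
IsComplete {d} {L} G =
  (∀ (k : Fin d) (i : L) → nbr G k i ≢ k) ×
  (∀ (k w : Fin d) → k ≢ w → ∃ λ (i : L) → nbr G k i ≡ w)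

CycAdj : (d : ℕ) → Fin d → Fin d → Set
CycAdj d k w =
  (toℕ w ≡ suc (toℕ k)) ⊎ (toℕ k ≡ suc (toℕ w)) ⊎
  ((toℕ k ≡ 0 × suc (toℕ w) ≡ d) ⊎ (toℕ w ≡ 0 × suc (toℕ k) ≡ d))

IsCycle : {d : ℕ} {L : Set} → RotMap (Fin d) L → Set
IsCycle {d} {L} G =
  (∀ (k : Fin d) (i : L) → CycAdj d k (nbr G k i)) ×
  (∀ (k w : Fin d) → CycAdj d k w → ∃ λ (i : L) → nbr G k i ≡ w)

module Submission where

-- The zig-zag product G ∘z H of a connected d-regular graph G with a graph H
-- on [d] is connected as soon as the SQUARE of H (two-step walks in H) is
-- connected.  Indeed, a square step k → k′ → k″ inside a cloud {v} × [d] is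
-- realised by two zig-zag edges that travel along a G-edge at k′ and then
-- straight back; and an edge v → w of G is followed by first moving, inside
-- the cloud of v, to a vertex adjacent in H to the colour of that edge.

open import Defs
open import Data.Nat using (ℕ; _≤_; _∸_)
open import Data.Nat.Divisibility using (_∣_)
open import Data.Fin using (Fin)
open import Data.Product using (_×_)
open import Relation.Nullary using (¬_)

open import Data.Nat using (zero; suc; _+_; _*_; s≤s)
open import Data.Nat.Properties using (+-suc; +-comm; suc-injective)
open import Data.Nat.Divisibility using (divides)
open import Data.Fin using (zero; suc; toℕ; inject₁; fromℕ)
open import Data.Fin.Properties using (toℕ-injective; toℕ-inject₁; toℕ-fromℕ)
open import Data.Product using (∃; _,_; proj₁; proj₂)
open import Data.Sum using (_⊎_; inj₁; inj₂)
open import Data.Empty using (⊥-elim)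
open import Relation.Binary.PropositionalEquality
  using (_≡_; _≢_; refl; sym; trans; cong; subst; ≢-sym)
open import Relation.Binary.Construct.Closure.ReflexiveTransitive
  using (Star; ε; _◅_; _◅◅_; map; reverse; kleisliStar)

record Square {A : Set} (R : A → A → Set) (a c : A) : Set where
  constructor square
  field
    via    : A
    first  : R a via
    second : R via c

Square-map : {A : Set} {R R′ : A → A → Set} →
             (∀ a b → R a b → R′ a b) → ∀ {a c} → Square R a c → Square R′ a c
Square-map f (square b ab bc) = square b (f _ _ ab) (f _ _ bc)

Square-sym : {A : Set} {R : A → A → Set} →
             (∀ a b → R a b → R b a) → ∀ {a c} → Square R a c → Square R c a
Square-sym s (square b ab bc) = square b (s _ _ bc) (s _ _ ab)

rot-back : {V L : Set} (G : RotMap V L) (v : V) (h : L) →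
           nbr G (nbr G v h) (proj₂ (rot G (v , h))) ≡ v
rot-back G v h = cong proj₁ (invol G (v , h))

in-neighbour : {V L : Set} (G : RotMap V L) → L → (c : V) → ∃ λ k → Adj (rot G) k c
in-neighbour G h c = nbr G c h , proj₂ (rot G (c , h)) , rot-back G c h

module ZigZag {V L : Set} {d : ℕ} (G : RotMap V (Fin d)) (H : RotMap (Fin d) L) where

  Walk : V × Fin d → V × Fin d → Set
  Walk = Star (Adj (zigzag G H))

  zigzag-edge : ∀ {v k k′ w l′ l} (i j : L) → nbr H k i ≡ k′ →
                rot G (v , k′) ≡ (w , l′) → nbr H l′ j ≡ l →
                Adj (zigzag G H) (v , k) (w , l)
  zigzag-edge {v} {k} {w = w} {l′} i j refl eG refl = (i , j) , lands
    where
    lands : proj₁ (zigzag G H ((v , k) , (i , j))) ≡ (w , nbr H l′ j)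
    lands rewrite eG = refl

  -- A square step of H inside the cloud of v: go along the G-edge at k′
  -- (landing somewhere in the cloud of w) and come straight back.
  square-step : L → ∀ v {k k″} → Square (Adj (rot H)) k k″ → Walk (v , k) (v , k″)
  square-step j v (square k′ (i , kk′) (i′ , k′k″)) =
    zigzag-edge i j kk′ refl refl ◅
    zigzag-edge (proj₂ (rot H (l′ , j))) i′ (rot-back H l′ j) (invol G (v , k′)) k′k″ ◅ ε
    where
    l′ = proj₂ (rot G (v , k′))

  in-cloud : L → ∀ v {k k″} → Star (Square (Adj (rot H))) k k″ → Walk (v , k) (v , k″)
  in-cloud j v = kleisliStar (v ,_) (square-step j v)

  lift-walk : L → (∀ k k′ → Star (Square (Adj (rot H))) k k′) →
              ∀ {v w} → Star (Adj (rot G)) v w → ∀ k l → Walk (v , k) (w , l)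
  lift-walk j sq {v} ε k l = in-cloud j v (sq k l)
  lift-walk j sq {v} ((c , vw) ◅ walk) k l with in-neighbour H j c
  ... | k₀ , i , k₀c =
    in-cloud j v (sq k k₀) ◅◅
    (zigzag-edge i j k₀c (cong (_, proj₂ (rot G (v , c))) vw) refl ◅ lift-walk j sq walk _ l)

  zigzag-connected : L → (∀ k k′ → Star (Square (Adj (rot H))) k k′) →
                     Connected (rot G) → Connected (zigzag G H)
  zigzag-connected j sq conn (v , k) (w , l) = lift-walk j sq (conn v w) k l

third : ∀ {m} (a b : Fin (suc (suc (suc m)))) → ∃ λ c → c ≢ a × c ≢ b
third zero          zero          = suc zero , (λ ()) , (λ ())
third zero          (suc zero)    = suc (suc zero) , (λ ()) , (λ ())
third zero          (suc (suc _)) = suc zero , (λ ()) , (λ ())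
third (suc zero)    zero          = suc (suc zero) , (λ ()) , (λ ())
third (suc (suc _)) zero          = suc zero , (λ ()) , (λ ())
third (suc _)       (suc _)       = zero , (λ ()) , (λ ())

-- The square of K_d (d ≥ 3) is complete: k and k′ share the neighbour c.
complete-square : ∀ {m L} (K : RotMap (Fin (suc (suc (suc m)))) L) → IsComplete K →
                  ∀ k k′ → Square (Adj (rot K)) k k′
complete-square K (_ , adjacent) k k′ with third k k′
... | c , c≢k , c≢k′ = square c (adjacent k c (≢-sym c≢k)) (adjacent c k′ c≢k′)

-- Every natural number is even or odd (written q * 2 + r so that
-- suc q * 2 + r unfolds to suc (suc (q * 2 + r))).
parity : ∀ m → ∃ λ q → m ≡ q * 2 + 0 ⊎ m ≡ q * 2 + 1
parity zero = zero , inj₁ refl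
parity (suc m) with parity m
... | q , inj₁ even = q , inj₂ (trans (cong suc even) (sym (+-suc (q * 2) 0)))
... | q , inj₂ odd  = suc q , inj₁ (cong suc (trans odd (+-suc (q * 2) 0)))

CycAdj-sym : ∀ {d} (a b : Fin d) → CycAdj d a b → CycAdj d b a
CycAdj-sym _ _ (inj₁ up)                 = inj₂ (inj₁ up)
CycAdj-sym _ _ (inj₂ (inj₁ down))        = inj₁ down
CycAdj-sym _ _ (inj₂ (inj₂ (inj₁ wrap))) = inj₂ (inj₂ (inj₂ wrap))
CycAdj-sym _ _ (inj₂ (inj₂ (inj₂ wrap))) = inj₂ (inj₂ (inj₁ wrap))

cycle-down : ∀ {d} (k : Fin d) m → toℕ k ≡ suc m → ∃ λ k′ → toℕ k′ ≡ m × CycAdj d k k′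
cycle-down (suc j) m k≡1+m =
  inject₁ j , trans (toℕ-inject₁ j) (suc-injective k≡1+m) ,
  inj₂ (inj₁ (cong suc (sym (toℕ-inject₁ j))))

cycle-descend : ∀ {d} q r (k : Fin d) → toℕ k ≡ q * 2 + r →
                ∃ λ k′ → toℕ k′ ≡ r × Star (Square (CycAdj d)) k k′
cycle-descend zero    r k k≡r = k , k≡r , ε
cycle-descend (suc q) r k k≡2q+2+r with cycle-down k _ k≡2q+2+r
... | k₁ , k₁≡ , kk₁ with cycle-down k₁ _ k₁≡
... | k₂ , k₂≡ , k₁k₂ with cycle-descend q r k₂ k₂≡
... | k′ , k′≡r , walk = k′ , k′≡r , square k₁ kk₁ k₁k₂ ◅ walk

module OddCycle (n : ℕ) (odd : ¬ 2 ∣ suc n) where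

  Reach0 : Fin (suc n) → Set
  Reach0 k = Star (Square (CycAdj (suc n))) k zero

  even-reach0 : ∀ q (k : Fin (suc n)) → toℕ k ≡ q * 2 + 0 → Reach0 k
  even-reach0 q k k≡2q with cycle-descend q 0 k k≡2q
  ... | k′ , k′≡0 , walk = subst (Star _ k) (toℕ-injective k′≡0) walk

  last-even : ∃ λ Q → n ≡ Q * 2 + 0
  last-even with parity n
  ... | Q , inj₁ even = Q , even
  ... | Q , inj₂ odd′ = ⊥-elim (odd (divides (suc Q) (cong suc (trans odd′ (+-comm (Q * 2) 1)))))

  -- Vertex 1 reaches 0 by the square step 1 → 0 → n and then descending.
  one-reach0 : ∀ (k : Fin (suc n)) → toℕ k ≡ 1 → Reach0 k
  one-reach0 k k≡1 with last-even
  ... | Q , n≡2Q =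
    square zero (inj₂ (inj₁ k≡1)) (inj₂ (inj₂ (inj₁ (refl , cong suc (toℕ-fromℕ n))))) ◅
    even-reach0 Q (fromℕ n) (trans (toℕ-fromℕ n) n≡2Q)

  reach0 : ∀ k → Reach0 k
  reach0 k with parity (toℕ k)
  ... | q , inj₁ even = even-reach0 q k even
  ... | q , inj₂ odd′ with cycle-descend q 1 k odd′
  ...   | k₁ , k₁≡1 , walk = walk ◅◅ one-reach0 k₁ k₁≡1

  cycle-square-connected : ∀ k k′ → Star (Square (CycAdj (suc n))) k k′
  cycle-square-connected k k′ = reach0 k ◅◅ reverse (Square-sym CycAdj-sym) (reach0 k′)

corollary3p2 : (n d : ℕ) → 3 ≤ d → (G : RotMap (Fin n) (Fin d)) → Connected (rot G) →
    ((K : RotMap (Fin d) (Fin (d ∸ 1))) → IsComplete K → Connected (zigzag G K)) ×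
    (¬ (2 ∣ d) → (C : RotMap (Fin d) (Fin 2)) → IsCycle C → Connected (zigzag G C))
corollary3p2 n (suc (suc (suc m))) (s≤s (s≤s (s≤s _))) G connG =
  (λ K isK → ZigZag.zigzag-connected G K zero
               (λ k k′ → complete-square K isK k k′ ◅ ε) connG) ,
  (λ odd C (_ , adjacent) → ZigZag.zigzag-connected G C zero
               (λ k k′ → map (Square-map adjacent)
                             (OddCycle.cycle-square-connected _ odd k k′))
               connG)
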